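{- Let $\mathcal{C}$ be complete with terminal object $1$, $F\colon\mathcal{C}\to\mathcal{C}$, and $\Sigma=\{e^{(i)}\colon E_i\subseteq F^{n_i}\mid i\in I\}$ a system of singular path constraints, with terminal net $\mathcal{N}\colon\mathbf{W}\Sigma\to\mathcal{C}$. For any word $w$, let $(\lim(\mathcal{N}\circ\mathrm{Incl}_w),d^w)$ be a limit cone of $\mathcal{N}\circ\mathrm{Incl}_w$ and $(\lim([\![w]\!]\circ\mathcal{N}),c^w)$ a limit cone of $[\![w]\!]\circ\mathcal{N}$. Then the family $(d^w_{wu})_u$ makes $\lim(\mathcal{N}\circ\mathrm{Incl}_w)$ a cone over $[\![w]\!]\circ\mathcal{N}$ and there is a unique cone homomorphism $\phi^w\colon(\lim(\mathcal{N}\circ\mathrm{Incl}_w),d^w)\to(\lim([\![w]\!]\circ\mathcal{N}),c^w)$. If $F$ and every $E_i$ are pitched-continuous, then $\phi^w$ is a cone isomorphism.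
   Context: Standing assumption: $F$ and all $E_i$ preserve monics. A singular path constraint of length $n$ is a functor $E$ with a natural transformation $e\colon E\Rightarrow F^n$ with monic components ($F^0=\mathrm{Id}$, $F^{n+1}=F\circ F^n$). Terminal net: $\mathbf{W}\Sigma$ is the free category whose objects are words over the alphabet $\{\mathtt F\}\cup\{\mathtt E_i\mid i\in I\}$ ($\bullet$ the empty word) and whose arrows are generated by: $!_w\colon w\to\bullet$; $\mathtt e^{(i)}_w\colon\mathtt E_iw\to\mathtt F^{n_i}w$; and for each arrow $f\colon w\to u$ and $i$, arrows $\mathtt F(f)\colon\mathtt Fw\to\mathtt Fu$ and $\mathtt E_i(f)\colon\mathtt E_iw\to\mathtt E_iu$. For a word $w$, $[\![w]\!]\colon\mathcal{C}\to\mathcal{C}$ is defined by $[\![\bullet]\!]=\mathrm{Id}$, $[\![\mathtt Fw]\!]=F\circ[\![w]\!]$, $[\![\mathtt E_iw]\!]=E_i\circ[\![w]\!]$. The functor $\mathcal{N}$ has $\mathcal{N}w=[\![w]\!]1$, $\mathcal{N}(!_w)$ the unique arrow to $1$, $\mathcal{N}(\mathtt e^{(i)}_w)=e^{(i)}_{\mathcal{N}w}$, $\mathcal{N}(\mathtt F(f))=F\mathcal{N}(f)$, $\mathcal{N}(\mathtt E_i(f))=E_i\mathcal{N}(f)$, preserving identities and composition. Thus $\mathcal{N}(wu)=[\![w]\!]\mathcal{N}(u)$. $w\mathbf{W}\Sigma$ is the full subcategory of $\mathbf{W}\Sigma$ on words beginning with $w$, with inclusion $\mathrm{Incl}_w$.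 A pitched diagram is a commutative diagram $D\colon\mathbf{D}\to\mathcal{C}$ containing a central $\omega^{op}$-chain $\{\alpha_i\colon A_{i+1}\to A_i\}_{i\in\mathbb{N}}$ in $\mathbf{D}$, meaning every object $B$ of $\mathbf{D}$ has an arrow $e_B\colon B\to A_i$ for some $i$ with $D(e_B)$ monic. A functor is pitched-continuous if it preserves limits of pitched diagrams. -}

module Defs where

open import Level using (Level; _⊔_) renaming (suc to lsuc)
open import Data.Nat using (ℕ; zero; suc)
open import Data.List using (List; []; _∷_; _++_)
open import Data.Product using (Σ; _×_; _,_; proj₁; proj₂)
open import Relation.Binary using (Rel; IsEquivalence)
open import Relation.Binary.PropositionalEquality as Eq using (_≡_; refl; cong; cong₂; subst)

record Category (o ℓ e : Level) : Set (lsuc (o ⊔ ℓ ⊔ e)) where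
  infixr 9 _∘_
  infix 4 _≈_ _⇒_
  field
    Obj : Set o
    _⇒_ : Obj → Obj → Set ℓ
    _≈_ : ∀ {A B} → Rel (A ⇒ B) e
    id : ∀ {A} → A ⇒ A
    _∘_ : ∀ {A B C} → B ⇒ C → A ⇒ B → A ⇒ C
    assoc : ∀ {A B C D} {f : A ⇒ B} {g : B ⇒ C} {h : C ⇒ D} →
            (h ∘ g) ∘ f ≈ h ∘ (g ∘ f)
    identityˡ : ∀ {A B} {f : A ⇒ B} → id ∘ f ≈ f
    identityʳ : ∀ {A B} {f : A ⇒ B} → f ∘ id ≈ f
    equiv : ∀ {A B} → IsEquivalence (_≈_ {A} {B})
    ∘-resp-≈ : ∀ {A B C} {f h : B ⇒ C} {g i : A ⇒ B} →
               f ≈ h → g ≈ i → f ∘ g ≈ h ∘ i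

  ≈-refl : ∀ {A B} {f : A ⇒ B} → f ≈ f
  ≈-refl = IsEquivalence.refl equiv
  ≈-sym : ∀ {A B} {f g : A ⇒ B} → f ≈ g → g ≈ f
  ≈-sym = IsEquivalence.sym equiv
  ≈-trans : ∀ {A B} {f g h : A ⇒ B} → f ≈ g → g ≈ h → f ≈ h
  ≈-trans = IsEquivalence.trans equiv

record Functor {o ℓ e o′ ℓ′ e′ : Level} (C : Category o ℓ e) (D : Category o′ ℓ′ e′)
       : Set (o ⊔ ℓ ⊔ e ⊔ o′ ⊔ ℓ′ ⊔ e′) where
  open Category C renaming (Obj to CObj; _⇒_ to _⇒C_; _≈_ to _≈C_; id to idC; _∘_ to _∘C_)
  open Category D renaming (Obj to DObj; _⇒_ to _⇒D_; _≈_ to _≈D_; id to idD; _∘_ to _∘D_)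
  field
    F₀ : CObj → DObj
    F₁ : ∀ {A B} → A ⇒C B → F₀ A ⇒D F₀ B
    identity : ∀ {A} → F₁ (idC {A}) ≈D idD
    homomorphism : ∀ {X Y Z} {f : X ⇒C Y} {g : Y ⇒C Z} →
                   F₁ (g ∘C f) ≈D F₁ g ∘D F₁ f
    F-resp-≈ : ∀ {A B} {f g : A ⇒C B} → f ≈C g → F₁ f ≈D F₁ g

open Functor public using (F₀; F₁)

module _ {o ℓ e : Level} {C : Category o ℓ e} where
  open Category C

  IdF : Functor C C
  IdF = record
    { F₀ = λ A → A ; F₁ = λ f → f ; identity = ≈-refl
    ; homomorphism = ≈-refl ; F-resp-≈ = λ p → p }

module _ {o ℓ e o′ ℓ′ e′ o″ ℓ″ e″ : Level}
         {B : Category o ℓ e} {C : Category o′ ℓ′ e′} {D : Category o″ ℓ″ e″} where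
  open Category D

  _∘F_ : Functor C D → Functor B C → Functor B D
  G ∘F H = record
    { F₀ = λ A → F₀ G (F₀ H A)
    ; F₁ = λ f → F₁ G (F₁ H f)
    ; identity = ≈-trans (Functor.F-resp-≈ G (Functor.identity H)) (Functor.identity G)
    ; homomorphism = ≈-trans (Functor.F-resp-≈ G (Functor.homomorphism H))
                             (Functor.homomorphism G)
    ; F-resp-≈ = λ p → Functor.F-resp-≈ G (Functor.F-resp-≈ H p) }

module _ {o ℓ e o′ ℓ′ e′ : Level} {C : Category o ℓ e} {D : Category o′ ℓ′ e′} where
  open Category D

  record NatTrans (F G : Functor C D) : Set (o ⊔ ℓ ⊔ ℓ′ ⊔ e′) where
    field
      η : ∀ A → F₀ F A ⇒ F₀ G A
      commute : ∀ {A B} (f : Category._⇒_ C A B) → η B ∘ F₁ F f ≈ F₁ G f ∘ η A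

open NatTrans public using (η)

module _ {o ℓ e′ : Level} (C : Category o ℓ e′) where
  open Category C

  Pow : Functor C C → ℕ → Functor C C
  Pow F zero = IdF
  Pow F (suc n) = F ∘F Pow F n

  Mono : ∀ {A B} → A ⇒ B → Set (o ⊔ ℓ ⊔ e′)
  Mono {A} f = ∀ {X} (g h : X ⇒ A) → f ∘ g ≈ f ∘ h → g ≈ h

  PreservesMonos : Functor C C → Set (o ⊔ ℓ ⊔ e′)
  PreservesMonos F = ∀ {A B} (f : A ⇒ B) → Mono f → Mono (F₁ F f)

  record Terminal : Set (o ⊔ ℓ ⊔ e′) where
    field
      ⊤ : Obj
      ! : ∀ {A} → A ⇒ ⊤
      !-unique : ∀ {A} (f : A ⇒ ⊤) → ! ≈ f

  module _ {s₁ s₂ s₃ : Level} {J : Category s₁ s₂ s₃} where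
    private module J = Category J

    record Cone (D : Functor J C) : Set (o ⊔ ℓ ⊔ e′ ⊔ s₁ ⊔ s₂) where
      field
        apex : Obj
        ψ : ∀ X → apex ⇒ F₀ D X
        commute : ∀ {X Y} (f : X J.⇒ Y) → F₁ D f ∘ ψ X ≈ ψ Y

    record ConeMorphism {D : Functor J C} (K L : Cone D) : Set (ℓ ⊔ e′ ⊔ s₁) where
      field
        arr : Cone.apex K ⇒ Cone.apex L
        commute : ∀ X → Cone.ψ L X ∘ arr ≈ Cone.ψ K X

    IsLimit : {D : Functor J C} → Cone D → Set (o ⊔ ℓ ⊔ e′ ⊔ s₁ ⊔ s₂)
    IsLimit {D} L = ∀ (K : Cone D) →
      Σ (ConeMorphism K L) λ φ →
        ∀ (φ′ : ConeMorphism K L) → ConeMorphism.arr φ′ ≈ ConeMorphism.arr φ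

    Limit : Functor J C → Set (o ⊔ ℓ ⊔ e′ ⊔ s₁ ⊔ s₂)
    Limit D = Σ (Cone D) IsLimit

    IsConeIso : {D : Functor J C} {K L : Cone D} → ConeMorphism K L → Set (ℓ ⊔ e′ ⊔ s₁)
    IsConeIso {K = K} {L} φ =
      Σ (ConeMorphism L K) λ χ →
        (ConeMorphism.arr χ ∘ ConeMorphism.arr φ ≈ id) ×
        (ConeMorphism.arr φ ∘ ConeMorphism.arr χ ≈ id)

    mapCone : (G : Functor C C) {D : Functor J C} → Cone D → Cone (G ∘F D)
    mapCone G {D} K = record
      { apex = F₀ G (Cone.apex K)
      ; ψ = λ X → F₁ G (Cone.ψ K X)
      ; commute = λ f → ≈-trans (≈-sym (Functor.homomorphism G))
                                (Functor.F-resp-≈ G (Cone.commute K f)) }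

    -- pitched diagram: a (commutative) diagram D : J → C together with a
    -- central ω^op-chain (a i, α i : a (i+1) → a i) in J such that every
    -- object B of J has some e_B : B → a i with D(e_B) monic
    IsPitched : Functor J C → Set (o ⊔ ℓ ⊔ e′ ⊔ s₁ ⊔ s₂)
    IsPitched D =
      Σ (ℕ → J.Obj) λ a →
      Σ (∀ i → a (suc i) J.⇒ a i) λ α →
        ∀ (B : J.Obj) → Σ ℕ λ i → Σ (B J.⇒ a i) λ eB → Mono (F₁ D eB)

  Complete : (s : Level) → Set (o ⊔ ℓ ⊔ e′ ⊔ lsuc s)
  Complete s = ∀ (J : Category s s s) (D : Functor J C) → Limit D

  PitchedContinuous : (s : Level) → Functor C C → Set (o ⊔ ℓ ⊔ e′ ⊔ lsuc s)
  PitchedContinuous s G =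
    ∀ (J : Category s s s) (D : Functor J C) → IsPitched D →
      (L : Cone D) → IsLimit L → IsLimit (mapCone G L)

  record PathSystem (s : Level) : Set (o ⊔ ℓ ⊔ e′ ⊔ lsuc s) where
    field
      F : Functor C C
      I : Set s
      n : I → ℕ
      E : I → Functor C C
      e : ∀ i → NatTrans (E i) (Pow F (n i))
      e-mono : ∀ i A → Mono (η (e i) A)

data Letter {s : Level} (I : Set s) : Set s where
  𝐅 : Letter I
  𝐄 : I → Letter I

Word : {s : Level} → Set s → Set s
Word I = List (Letter I)

Fword : ∀ {s} {I : Set s} → ℕ → Word I → Word I
Fword zero w = w
Fword (suc m) w = 𝐅 ∷ Fword m w

module Free {s : Level} {I : Set s} (n : I → ℕ) where
  mutual
    data Gen : Word I → Word I → Set s where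
      !ʷ : ∀ w → Gen w []
      𝐞 : ∀ i w → Gen (𝐄 i ∷ w) (Fword (n i) w)
      𝐅₁ : ∀ {w u} → Path w u → Gen (𝐅 ∷ w) (𝐅 ∷ u)
      𝐄₁ : ∀ i {w u} → Path w u → Gen (𝐄 i ∷ w) (𝐄 i ∷ u)

    data Path : Word I → Word I → Set s where
      nil : ∀ {w} → Path w w
      _◅_ : ∀ {w u v} → Gen u v → Path w u → Path w v

  infixr 9 _⊚_
  _⊚_ : ∀ {w u v} → Path u v → Path w u → Path w v
  nil ⊚ q = q
  (g ◅ p) ⊚ q = g ◅ (p ⊚ q)

  ⊚-assoc : ∀ {a b c d} (f : Path a b) (g : Path b c) (h : Path c d) →
            (h ⊚ g) ⊚ f ≡ h ⊚ (g ⊚ f)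
  ⊚-assoc f g nil = refl
  ⊚-assoc f g (x ◅ h) = cong (x ◅_) (⊚-assoc f g h)

  ⊚-idʳ : ∀ {a b} (f : Path a b) → f ⊚ nil ≡ f
  ⊚-idʳ nil = refl
  ⊚-idʳ (x ◅ f) = cong (x ◅_) (⊚-idʳ f)

  WΣ : Category s s s
  WΣ = record
    { Obj = Word I ; _⇒_ = Path ; _≈_ = _≡_ ; id = nil ; _∘_ = _⊚_
    ; assoc = λ {_} {_} {_} {_} {f} {g} {h} → ⊚-assoc f g h
    ; identityˡ = refl ; identityʳ = λ {_} {_} {f} → ⊚-idʳ f
    ; equiv = Eq.isEquivalence ; ∘-resp-≈ = cong₂ _⊚_ }

  -- prefixCat w = w WΣ : the full subcategory of WΣ on words beginning with w,
  -- indexed by the suffix u (object u stands for the word w u)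
  prefixCat : Word I → Category s s s
  prefixCat w = record
    { Obj = Word I ; _⇒_ = λ u u′ → Path (w ++ u) (w ++ u′) ; _≈_ = _≡_
    ; id = nil ; _∘_ = _⊚_
    ; assoc = λ {_} {_} {_} {_} {f} {g} {h} → ⊚-assoc f g h
    ; identityˡ = refl ; identityʳ = λ {_} {_} {f} → ⊚-idʳ f
    ; equiv = Eq.isEquivalence ; ∘-resp-≈ = cong₂ _⊚_ }

  Incl : (w : Word I) → Functor (prefixCat w) WΣ
  Incl w = record
    { F₀ = λ u → w ++ u ; F₁ = λ f → f ; identity = refl
    ; homomorphism = refl ; F-resp-≈ = λ p → p }

module Net {o ℓ e′ s : Level} (C : Category o ℓ e′) (T : Terminal C) (S : PathSystem C s) where
  open Category C
  open Terminal T
  open PathSystem S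
  open Free n public

  ⟦_⟧ : Word I → Functor C C
  ⟦ [] ⟧ = IdF
  ⟦ 𝐅 ∷ w ⟧ = F ∘F ⟦ w ⟧
  ⟦ 𝐄 i ∷ w ⟧ = E i ∘F ⟦ w ⟧

  N₀ : Word I → Obj
  N₀ w = F₀ ⟦ w ⟧ ⊤

  N₀-Fword : ∀ m w → N₀ (Fword m w) ≡ F₀ (Pow C F m) (N₀ w)
  N₀-Fword zero w = refl
  N₀-Fword (suc m) w = cong (F₀ F) (N₀-Fword m w)

  mutual
    NG : ∀ {w u} → Gen w u → N₀ w ⇒ N₀ u
    NG (!ʷ w) = !
    NG (𝐞 i w) = subst (λ X → F₀ (E i) (N₀ w) ⇒ X) (Eq.sym (N₀-Fword (n i) w))
                       (η (e i) (N₀ w))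
    NG (𝐅₁ p) = F₁ F (NP p)
    NG (𝐄₁ i p) = F₁ (E i) (NP p)

    NP : ∀ {w u} → Path w u → N₀ w ⇒ N₀ u
    NP nil = id
    NP (g ◅ p) = NG g ∘ NP p

  NP-⊚ : ∀ {a b c} (f : Path a b) (g : Path b c) → NP (g ⊚ f) ≈ NP g ∘ NP f
  NP-⊚ f nil = ≈-sym identityˡ
  NP-⊚ f (x ◅ g) = ≈-trans (∘-resp-≈ ≈-refl (NP-⊚ f g)) (≈-sym assoc)

  N : Functor WΣ C
  N = record
    { F₀ = N₀ ; F₁ = NP ; identity = ≈-refl
    ; homomorphism = λ {_} {_} {_} {f} {g} → NP-⊚ f g
    ; F-resp-≈ = λ { refl → ≈-refl } }

  N₀-++ : ∀ w u → N₀ (w ++ u) ≡ F₀ ⟦ w ⟧ (N₀ u)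
  N₀-++ [] u = refl
  N₀-++ (𝐅 ∷ w) u = cong (F₀ F) (N₀-++ w u)
  N₀-++ (𝐄 i ∷ w) u = cong (F₀ (E i)) (N₀-++ w u)

  module _ (w : Word I) where
    dfam : (d : Cone C (N ∘F Incl w)) → ∀ u → Cone.apex d ⇒ F₀ ⟦ w ⟧ (N₀ u)
    dfam d u = subst (λ X → Cone.apex d ⇒ X) (N₀-++ w u) (Cone.ψ d u)

    IsConeOver⟦w⟧N : Cone C (N ∘F Incl w) → Set (e′ ⊔ s)
    IsConeOver⟦w⟧N d = ∀ {u u′} (f : Path u u′) →
      F₁ (⟦ w ⟧ ∘F N) f ∘ dfam d u ≈ dfam d u′

    asCone : (d : Cone C (N ∘F Incl w)) → IsConeOver⟦w⟧N d → Cone C (⟦ w ⟧ ∘F N)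
    asCone d comm = record { apex = Cone.apex d ; ψ = dfam d ; commute = comm }

-- Up to the identification N (w u) = ⟦ w ⟧ (N u), every arrow w u → w u′ of WΣ has the same
-- image under N as ⟦ w ⟧ applied to an arrow u → u′, found by peeling off the letters of w:
-- an arrow from F x to an F-headed word is F of an arrow, and one from E i x to an E i-headed
-- word is E i of an arrow, because such a path can only leave and re-enter the E i-headed words
-- through e (i) with n i = 0, and that arrow is monic. Conversely every arrow u → u′ lifts to
-- w u → w u′. Hence cones over N ∘ Incl w and over ⟦ w ⟧ ∘ N are the same thing, d is itself a
-- limit of ⟦ w ⟧ ∘ N, and φ, a morphism between two limit cones, is an isomorphism.

module Submission where

open import Level using (_⊔_)
open import Data.List using ([]; _∷_; _++_)
open import Data.Nat using (zero; suc)
open import Data.Product using (Σ; _×_; _,_; proj₁; proj₂)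
open import Data.Sum using (_⊎_; inj₁; inj₂)
open import Data.Unit using (⊤; tt)
open import Data.Empty using (⊥)
open import Relation.Binary.Bundles using (Setoid)
open import Relation.Binary.PropositionalEquality using (_≡_; refl; sym; cong; subst)
import Relation.Binary.Reasoning.Setoid as SetoidReasoning

open import Defs

module CategoryFacts {o ℓ e} (C : Category o ℓ e) where
  open Category C

  hom-setoid : Obj → Obj → Setoid ℓ e
  hom-setoid A B = record { Carrier = A ⇒ B ; _≈_ = _≈_ ; isEquivalence = equiv }

  module HomReasoning {A B : Obj} = SetoidReasoning (hom-setoid A B)
  open HomReasoning public

  infixr 4 refl⟩∘⟨_
  infixl 5 _⟩∘⟨refl

  refl⟩∘⟨_ : ∀ {A B D} {f : B ⇒ D} {g h : A ⇒ B} → g ≈ h → f ∘ g ≈ f ∘ h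
  refl⟩∘⟨ p = ∘-resp-≈ ≈-refl p

  _⟩∘⟨refl : ∀ {A B D} {f g : B ⇒ D} {h : A ⇒ B} → f ≈ g → f ∘ h ≈ g ∘ h
  p ⟩∘⟨refl = ∘-resp-≈ p ≈-refl

  sym-assoc : ∀ {A B D E} {f : A ⇒ B} {g : B ⇒ D} {h : D ⇒ E} → h ∘ (g ∘ f) ≈ (h ∘ g) ∘ f
  sym-assoc = ≈-sym assoc

  cast : ∀ {A B} → A ≡ B → A ⇒ B
  cast refl = id

  subst-⇒≈cast∘ : ∀ {A B B′} (p : B ≡ B′) (f : A ⇒ B) → subst (A ⇒_) p f ≈ cast p ∘ f
  subst-⇒≈cast∘ refl f = ≈-sym identityˡ

  cast-transpose : ∀ {A B X} (p : A ≡ B) {f : X ⇒ A} {g : X ⇒ B} →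
                   cast p ∘ f ≈ g → f ≈ cast (sym p) ∘ g
  cast-transpose refl h = ≈-trans (≈-sym identityˡ) (≈-trans h (≈-sym identityˡ))

  cast-transpose⁻ : ∀ {A B X} (p : A ≡ B) {f : X ⇒ A} {g : X ⇒ B} →
                    f ≈ cast (sym p) ∘ g → cast p ∘ f ≈ g
  cast-transpose⁻ refl h = ≈-trans identityˡ (≈-trans h identityˡ)

  cast-sym-inverse : ∀ {A B X} (p : A ≡ B) (g : X ⇒ B) → cast p ∘ (cast (sym p) ∘ g) ≈ g
  cast-sym-inverse p g = cast-transpose⁻ p ≈-refl

  infix 4 _≈[_,_]_

  -- f and g agree once their domains are identified along p and their codomains along q
  _≈[_,_]_ : ∀ {A A′ B B′} → A ⇒ B → A ≡ A′ → B ≡ B′ → A′ ⇒ B′ → Set e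
  f ≈[ p , q ] g = cast q ∘ f ≈ g ∘ cast p

  ≈[]-refl : ∀ {A B} {f g : A ⇒ B} → f ≈ g → f ≈[ refl , refl ] g
  ≈[]-refl h = ≈-trans identityˡ (≈-trans h (≈-sym identityʳ))

  F₁-resp-≈[] : (G : Functor C C) {A A′ B B′ : Obj} (p : A ≡ A′) (q : B ≡ B′)
                {f : A ⇒ B} {g : A′ ⇒ B′} →
                f ≈[ p , q ] g → F₁ G f ≈[ cong (F₀ G) p , cong (F₀ G) q ] F₁ G g
  F₁-resp-≈[] G refl refl h =
    ≈[]-refl (Functor.F-resp-≈ G (≈-trans (≈-sym identityˡ) (≈-trans h identityʳ)))

module Limits {o ℓ e} (C : Category o ℓ e) where
  open Category C
  open CategoryFacts C using (sym-assoc; _⟩∘⟨refl)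

  module _ {s₁ s₂ s₃} {J : Category s₁ s₂ s₃} {D : Functor J C} where

    id-morphism : (K : Cone C D) → ConeMorphism C K K
    id-morphism K = record { arr = id ; commute = λ _ → identityʳ }

    _∘-morphism_ : {K L M : Cone C D} → ConeMorphism C L M → ConeMorphism C K L →
                   ConeMorphism C K M
    f ∘-morphism g = record
      { arr = ConeMorphism.arr f ∘ ConeMorphism.arr g
      ; commute = λ X →
          ≈-trans sym-assoc (≈-trans (commute f X ⟩∘⟨refl) (commute g X)) }
      where open ConeMorphism

    limit-arr-unique : {K L : Cone C D} → IsLimit C L → (f g : ConeMorphism C K L) →
                       ConeMorphism.arr f ≈ ConeMorphism.arr g
    limit-arr-unique {K} L-limit f g =
      ≈-trans (proj₂ (L-limit K) f) (≈-sym (proj₂ (L-limit K) g))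

    morphism-between-limits-isIso : {K L : Cone C D} → IsLimit C K → IsLimit C L →
                                    (φ : ConeMorphism C K L) → IsConeIso C φ
    morphism-between-limits-isIso {K} {L} K-limit L-limit φ =
      χ ,
      limit-arr-unique K-limit (χ ∘-morphism φ) (id-morphism K) ,
      limit-arr-unique L-limit (φ ∘-morphism χ) (id-morphism L)
      where
      χ = proj₁ (K-limit L)

module ZeroLengthConstraint {o ℓ e} (C : Category o ℓ e) (F : Functor C C) where
  open Category C

  ε : ∀ {G : Functor C C} {k} → NatTrans G (Pow C F k) → k ≡ 0 → ∀ A → F₀ G A ⇒ A
  ε τ refl A = η τ A

  ε-natural : ∀ {G : Functor C C} {k} (τ : NatTrans G (Pow C F k)) (z : k ≡ 0)
              {A B} (f : A ⇒ B) → ε τ z B ∘ F₁ G f ≈ f ∘ ε τ z A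
  ε-natural τ refl f = NatTrans.commute τ f

  ε-mono : ∀ {G : Functor C C} {k} (τ : NatTrans G (Pow C F k)) →
           (∀ A → Mono C (η τ A)) → (z : k ≡ 0) (A : Obj) → Mono C (ε τ z A)
  ε-mono τ τ-mono refl A = τ-mono A

module TerminalNet {o ℓ e′ s} (C : Category o ℓ e′) (T : Terminal C) (S : PathSystem C s) where
  open Category C
  open PathSystem S
  open Net C T S
  open CategoryFacts C
  open ZeroLengthConstraint C F

  NoEHead : Word I → Set
  NoEHead (𝐄 _ ∷ _) = ⊥
  NoEHead _ = ⊤

  Fword-zero : ∀ {k} {y : Word I} → k ≡ 0 → Fword k y ≡ y
  Fword-zero refl = refl

  zero⊎Fword-NoEHead : ∀ k (y : Word I) → k ≡ 0 ⊎ NoEHead (Fword k y)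
  zero⊎Fword-NoEHead zero y = inj₁ refl
  zero⊎Fword-NoEHead (suc k) y = inj₂ tt

  -- NG (𝐞 i y) is N𝐞 (e i) y; abstracting over τ and k lets the case n i = 0 be handled
  -- by matching on k ≡ 0, which n i itself does not allow
  N𝐞 : ∀ {G : Functor C C} {k} → NatTrans G (Pow C F k) → ∀ y → F₀ G (N₀ y) ⇒ N₀ (Fword k y)
  N𝐞 {k = k} τ y = subst (_ ⇒_) (sym (N₀-Fword k y)) (η τ (N₀ y))

  N𝐞-natural-zero : ∀ {G : Functor C C} {k} (τ : NatTrans G (Pow C F k)) (z : k ≡ 0)
                    {x y} (r : Path x y) →
                    N𝐞 {k = k} τ y ∘ F₁ G (NP r)
                      ≈ NP (subst (Path x) (sym (Fword-zero z)) r) ∘ ε τ z (N₀ x)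
  N𝐞-natural-zero τ refl r = NatTrans.commute τ (NP r)

  NP-N𝐞-zero : ∀ {G : Functor C C} {k} (τ : NatTrans G (Pow C F k)) (z : k ≡ 0)
               {x y} (g : Path x (Fword k y)) {f : N₀ x ⇒ F₀ G (N₀ y)} →
               NP g ≈ N𝐞 {k = k} τ y ∘ f →
               NP (subst (Path x) (Fword-zero z) g) ≈ ε τ z (N₀ y) ∘ f
  NP-N𝐞-zero τ refl g h = h

  F₁-NP-extend : (G : Functor C C) → ∀ {x y y′} {f : F₀ G (N₀ x) ⇒ F₀ G (N₀ y)} {r : Path x y}
                 (r′ : Path y y′) →
                 f ≈ F₁ G (NP r) → F₁ G (NP r′) ∘ f ≈ F₁ G (NP (r′ ⊚ r))
  F₁-NP-extend G {r = r} r′ h = begin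
    F₁ G (NP r′) ∘ _            ≈⟨ refl⟩∘⟨ h ⟩
    F₁ G (NP r′) ∘ F₁ G (NP r)  ≈⟨ Functor.homomorphism G ⟨
    F₁ G (NP r′ ∘ NP r)         ≈⟨ Functor.F-resp-≈ G (NP-⊚ r r′) ⟨
    F₁ G (NP (r′ ⊚ r))          ∎

  data FShape {x : Word I} : ∀ {v} → Path (𝐅 ∷ x) v → Set (s ⊔ e′) where
    inside : ∀ {y} {p : Path (𝐅 ∷ x) (𝐅 ∷ y)} (r : Path x y) → NP p ≈ F₁ F (NP r) → FShape p
    terminal : {p : Path (𝐅 ∷ x) []} → FShape p

  F-extend : ∀ {x m v} (g : Gen m v) {p : Path (𝐅 ∷ x) m} → FShape p → FShape (g ◅ p)
  F-extend (!ʷ _) _ = terminal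
  F-extend (𝐅₁ r′) (inside r h) = inside (r′ ⊚ r) (F₁-NP-extend F r′ h)
  F-extend (𝐞 _ _) ()
  F-extend (𝐄₁ _ _) ()

  F-shape : ∀ {x v} (p : Path (𝐅 ∷ x) v) → FShape p
  F-shape nil = inside nil (≈-sym (Functor.identity F))
  F-shape (g ◅ p) = F-extend g (F-shape p)

  F-reflect : ∀ {x y} (p : Path (𝐅 ∷ x) (𝐅 ∷ y)) → Σ (Path x y) λ r → NP p ≈ F₁ F (NP r)
  F-reflect p with F-shape p
  ... | inside r h = r , h

  module _ (i : I) where

    data EShape {x : Word I} : ∀ {v} → Path (𝐄 i ∷ x) v → Set (s ⊔ e′) where
      inside : ∀ {y} {p : Path (𝐄 i ∷ x) (𝐄 i ∷ y)} (r : Path x y) →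
               NP p ≈ F₁ (E i) (NP r) → EShape p
      via-ε : ∀ {v} {p : Path (𝐄 i ∷ x) v} (z : n i ≡ 0) (r : Path x v) →
              NP p ≈ NP r ∘ ε (e i) z (N₀ x) → EShape p
      outside : ∀ {v} {p : Path (𝐄 i ∷ x) v} → NoEHead v → EShape p

    E-extend : ∀ {x m v} (g : Gen m v) {p : Path (𝐄 i ∷ x) m} → EShape p → EShape (g ◅ p)
    E-extend g (via-ε z r h) = via-ε z (g ◅ r) (≈-trans (refl⟩∘⟨ h) sym-assoc)
    E-extend (!ʷ _) _ = outside tt
    E-extend (𝐅₁ _) (outside _) = outside tt
    E-extend (𝐞 _ _) (outside ())
    E-extend (𝐄₁ _ _) (outside ())
    E-extend (𝐄₁ _ r′) (inside r h) = inside (r′ ⊚ r) (F₁-NP-extend (E i) r′ h)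
    E-extend (𝐞 _ y) (inside r h) with zero⊎Fword-NoEHead (n i) y
    ... | inj₁ z = via-ε z (subst (Path _) (sym (Fword-zero z)) r)
                         (≈-trans (refl⟩∘⟨ h) (N𝐞-natural-zero (e i) z r))
    ... | inj₂ ne = outside ne

    E-shape : ∀ {x v} (p : Path (𝐄 i ∷ x) v) → EShape p
    E-shape nil = inside nil (≈-sym (Functor.identity (E i)))
    E-shape (g ◅ p) = E-extend g (E-shape p)

    -- a detour E i x → x → E i y through e (i) (possible only when n i = 0) is undone
    -- by cancelling the monic ε
    E-reflect : ∀ {x y} (p : Path (𝐄 i ∷ x) (𝐄 i ∷ y)) →
                Σ (Path x y) λ r → NP p ≈ F₁ (E i) (NP r)
    E-reflect p with E-shape p
    ... | inside r h = r , h
    ... | outside ()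
    E-reflect {x} {y} p | via-ε z r h = q , ε-mono (e i) (e-mono i) z (N₀ y) _ _ (begin
        ε′ y ∘ NP p              ≈⟨ refl⟩∘⟨ h ⟩
        ε′ y ∘ (NP r ∘ ε′ x)     ≈⟨ sym-assoc ⟩
        (ε′ y ∘ NP r) ∘ ε′ x     ≈⟨ NP-N𝐞-zero (e i) z (𝐞 i y ◅ r) ≈-refl ⟩∘⟨refl ⟨
        NP q ∘ ε′ x              ≈⟨ ε-natural (e i) z (NP q) ⟨
        ε′ y ∘ F₁ (E i) (NP q)   ∎)
      where
      ε′ : ∀ a → F₀ (E i) (N₀ a) ⇒ N₀ a
      ε′ a = ε (e i) z (N₀ a)
      q : Path x y
      q = subst (Path x) (Fword-zero z) (𝐞 i y ◅ r)

  lift : ∀ w {u u′} → Path u u′ → Path (w ++ u) (w ++ u′)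
  lift [] f = f
  lift (𝐅 ∷ w) f = 𝐅₁ (lift w f) ◅ nil
  lift (𝐄 i ∷ w) f = 𝐄₁ i (lift w f) ◅ nil

  lift-≈[] : ∀ w {u u′} (f : Path u u′) →
             NP (lift w f) ≈[ N₀-++ w u , N₀-++ w u′ ] F₁ ⟦ w ⟧ (NP f)
  lift-≈[] [] f = ≈[]-refl ≈-refl
  lift-≈[] (𝐅 ∷ w) {u} {u′} f =
    ≈-trans (refl⟩∘⟨ identityʳ) (F₁-resp-≈[] F (N₀-++ w u) (N₀-++ w u′) (lift-≈[] w f))
  lift-≈[] (𝐄 i ∷ w) {u} {u′} f =
    ≈-trans (refl⟩∘⟨ identityʳ) (F₁-resp-≈[] (E i) (N₀-++ w u) (N₀-++ w u′) (lift-≈[] w f))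

  descend : ∀ w {u u′} (p : Path (w ++ u) (w ++ u′)) →
            Σ (Path u u′) λ f → NP p ≈[ N₀-++ w u , N₀-++ w u′ ] F₁ ⟦ w ⟧ (NP f)
  descend [] p = p , ≈[]-refl ≈-refl
  descend (𝐅 ∷ w) {u} {u′} p =
    let q , p≈Fq = F-reflect p
        f , q≈[]f = descend w q
    in f , ≈-trans (refl⟩∘⟨ p≈Fq) (F₁-resp-≈[] F (N₀-++ w u) (N₀-++ w u′) q≈[]f)
  descend (𝐄 i ∷ w) {u} {u′} p =
    let q , p≈Eq = E-reflect i p
        f , q≈[]f = descend w q
    in f , ≈-trans (refl⟩∘⟨ p≈Eq) (F₁-resp-≈[] (E i) (N₀-++ w u) (N₀-++ w u′) q≈[]f)

  module _ (w : Word I) where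

    dfam≈cast∘ψ : (d : Cone C (N ∘F Incl w)) (u : Word I) →
                  dfam w d u ≈ cast (N₀-++ w u) ∘ Cone.ψ d u
    dfam≈cast∘ψ d u = subst-⇒≈cast∘ (N₀-++ w u) (Cone.ψ d u)

    isConeOver⟦w⟧N : (d : Cone C (N ∘F Incl w)) → IsConeOver⟦w⟧N w d
    isConeOver⟦w⟧N d {u} {u′} f = begin
      F₁ ⟦ w ⟧ (NP f) ∘ dfam w d u                 ≈⟨ refl⟩∘⟨ dfam≈cast∘ψ d u ⟩
      F₁ ⟦ w ⟧ (NP f) ∘ (cast (N₀-++ w u) ∘ ψ d u) ≈⟨ sym-assoc ⟩
      (F₁ ⟦ w ⟧ (NP f) ∘ cast (N₀-++ w u)) ∘ ψ d u ≈⟨ lift-≈[] w f ⟩∘⟨refl ⟨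
      (cast (N₀-++ w u′) ∘ NP (lift w f)) ∘ ψ d u  ≈⟨ assoc ⟩
      cast (N₀-++ w u′) ∘ (NP (lift w f) ∘ ψ d u)  ≈⟨ refl⟩∘⟨ Cone.commute d (lift w f) ⟩
      cast (N₀-++ w u′) ∘ ψ d u′                  ≈⟨ dfam≈cast∘ψ d u′ ⟨
      dfam w d u′                                 ∎
      where open Cone

    asPrefixCone : Cone C (⟦ w ⟧ ∘F N) → Cone C (N ∘F Incl w)
    asPrefixCone K = record
      { apex = apex K
      ; ψ = λ u → cast (sym (N₀-++ w u)) ∘ ψ K u
      ; commute = λ {u} {u′} p → cast-transpose (N₀-++ w u′) (commute′ p) }
      where
      open Cone
      commute′ : ∀ {u u′} (p : Path (w ++ u) (w ++ u′)) →
                 cast (N₀-++ w u′) ∘ (NP p ∘ (cast (sym (N₀-++ w u)) ∘ ψ K u)) ≈ ψ K u′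
      commute′ {u} {u′} p = begin
        cast (N₀-++ w u′) ∘ (NP p ∘ (cast (sym (N₀-++ w u)) ∘ ψ K u))
          ≈⟨ sym-assoc ⟩
        (cast (N₀-++ w u′) ∘ NP p) ∘ (cast (sym (N₀-++ w u)) ∘ ψ K u)
          ≈⟨ proj₂ (descend w p) ⟩∘⟨refl ⟩
        (F₁ ⟦ w ⟧ (NP f) ∘ cast (N₀-++ w u)) ∘ (cast (sym (N₀-++ w u)) ∘ ψ K u)
          ≈⟨ assoc ⟩
        F₁ ⟦ w ⟧ (NP f) ∘ (cast (N₀-++ w u) ∘ (cast (sym (N₀-++ w u)) ∘ ψ K u))
          ≈⟨ refl⟩∘⟨ cast-sym-inverse (N₀-++ w u) (ψ K u) ⟩
        F₁ ⟦ w ⟧ (NP f) ∘ ψ K u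
          ≈⟨ Cone.commute K f ⟩
        ψ K u′ ∎
        where
        f = proj₁ (descend w p)

    asCone-isLimit : (d : Cone C (N ∘F Incl w)) → IsLimit C d →
                     IsLimit C (asCone w d (isConeOver⟦w⟧N d))
    asCone-isLimit d d-limit K =
      toAsCone (proj₁ (d-limit (asPrefixCone K))) ,
      λ φ → proj₂ (d-limit (asPrefixCone K)) (fromAsCone φ)
      where
      d′ = asCone w d (isConeOver⟦w⟧N d)

      toAsCone : ConeMorphism C (asPrefixCone K) d → ConeMorphism C K d′
      toAsCone m = record
        { arr = arr m
        ; commute = λ u → begin
            dfam w d u ∘ arr m                          ≈⟨ dfam≈cast∘ψ d u ⟩∘⟨refl ⟩
            (cast (N₀-++ w u) ∘ Cone.ψ d u) ∘ arr m     ≈⟨ assoc ⟩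
            cast (N₀-++ w u) ∘ (Cone.ψ d u ∘ arr m)
              ≈⟨ cast-transpose⁻ (N₀-++ w u) (commute m u) ⟩
            Cone.ψ K u                                  ∎ }
        where open ConeMorphism

      fromAsCone : ConeMorphism C K d′ → ConeMorphism C (asPrefixCone K) d
      fromAsCone φ = record
        { arr = arr φ
        ; commute = λ u → cast-transpose (N₀-++ w u) (begin
            cast (N₀-++ w u) ∘ (Cone.ψ d u ∘ arr φ)     ≈⟨ sym-assoc ⟩
            (cast (N₀-++ w u) ∘ Cone.ψ d u) ∘ arr φ     ≈⟨ dfam≈cast∘ψ d u ⟩∘⟨refl ⟨
            dfam w d u ∘ arr φ                          ≈⟨ commute φ u ⟩
            Cone.ψ K u                                  ∎) }
        where open ConeMorphism

lemma3 : ∀ {o ℓ e s} (C : Category o ℓ e) (T : Terminal C) → Complete C s →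
    (S : PathSystem C s) →
    PreservesMonos C (PathSystem.F S) → (∀ i → PreservesMonos C (PathSystem.E S i)) →
    (w : Word (PathSystem.I S)) →
    (d : Cone C (Net.N C T S ∘F Net.Incl C T S w)) → IsLimit C d →
    (c : Cone C (Net.⟦_⟧ C T S w ∘F Net.N C T S)) → IsLimit C c →
    Σ (Net.IsConeOver⟦w⟧N C T S w d) λ isCone →
      Σ (ConeMorphism C (Net.asCone C T S w d isCone) c) λ φ →
        (∀ (φ′ : ConeMorphism C (Net.asCone C T S w d isCone) c) →
           Category._≈_ C (ConeMorphism.arr φ′) (ConeMorphism.arr φ))
        × (PitchedContinuous C s (PathSystem.F S) →
           (∀ i → PitchedContinuous C s (PathSystem.E S i)) →
           IsConeIso C φ)
lemma3 C T _ S _ _ w d d-limit c c-limit =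
  isConeOver⟦w⟧N w d , φ , proj₂ (c-limit d′) ,
  λ _ _ → morphism-between-limits-isIso C (asCone-isLimit w d d-limit) c-limit φ
  where
  open TerminalNet C T S
  open Net C T S using (asCone)
  open Limits using (morphism-between-limits-isIso)
  d′ = asCone w d (isConeOver⟦w⟧N w d)
  φ = proj₁ (c-limit d′)
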